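{- Let $p$ be a prime and $A\subseteq\mathbb{F}_p$ a set. Then $|3A^2-3A^2|\ge\frac12\min(|A|^2,p)$.
   Context: For sets $X,Y\subseteq\mathbb{F}_p$, $X+Y=\{x+y\}$, $X-Y=\{x-y\}$, $X\cdot Y=\{xy\}$. For an integer $k\ge1$, $A^k=A\cdot A\cdots A$ ($k$ factors) and $kX=X+\dots+X$ ($k$ summands); thus $3A^2-3A^2=(A^2+A^2+A^2)-(A^2+A^2+A^2)$ where $A^2=A\cdot A$. -}

module Defs where

open import Data.Nat using (ℕ; NonZero; _∸_)
import Data.Nat as ℕ
open import Data.Nat.DivMod using (_mod_)
open import Data.Fin using (Fin; toℕ)
open import Data.Fin.Properties using (any?; _≟_)
open import Data.Fin.Subset using (Subset; _∈_)
open import Data.Fin.Subset.Properties using (_∈?_)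
open import Data.Vec using (tabulate)
open import Data.Product using (_×_)
open import Relation.Nullary using (does)
open import Relation.Nullary.Decidable using (_×-dec_)
open import Relation.Binary.PropositionalEquality using (_≡_)

-- The field 𝔽_p is modelled as Fin p = {0,…,p-1} with arithmetic modulo p.
module 𝔽 (p : ℕ) .{{_ : NonZero p}} where

  _+F_ : Fin p → Fin p → Fin p
  x +F y = (toℕ x ℕ.+ toℕ y) mod p

  _-F_ : Fin p → Fin p → Fin p
  x -F y = (toℕ x ℕ.+ (p ∸ toℕ y)) mod p

  _*F_ : Fin p → Fin p → Fin p
  x *F y = (toℕ x ℕ.* toℕ y) mod p

  setOp : (Fin p → Fin p → Fin p) → Subset p → Subset p → Subset p
  setOp _⊙_ X Y = tabulate λ z →
    does (any? λ x → any? λ y → (x ∈? X) ×-dec ((y ∈? Y) ×-dec (z ≟ (x ⊙ y))))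

  _⊕_ : Subset p → Subset p → Subset p
  _⊕_ = setOp _+F_

  _⊖_ : Subset p → Subset p → Subset p
  _⊖_ = setOp _-F_

  _⊗_ : Subset p → Subset p → Subset p
  _⊗_ = setOp _*F_

  threeA²-threeA² : Subset p → Subset p
  threeA²-threeA² A = ((A² ⊕ A²) ⊕ A²) ⊖ ((A² ⊕ A²) ⊕ A²)
    where
    A² = A ⊗ A

module Submission where

-- Let Q = (A - A)/(A - A).  If η ∈ Q + 1, say η(c - d) = (a - b) + (c - d)
-- with a, b, c, d ∈ A and c ≠ d, then
--   g(x , y) = (c x + a y + c y) - (d x + b y + d y) = (c - d)(x + η y)
-- maps A × A into 3A² - 3A², and each of its collisions is a collision of
-- the line map f_η(x , y) = x + η y.  A map of energy E on B × B, where
-- B ⊆ A and |B| = m, takes at least (3m² - E)/2 values, so it suffices to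
-- find η ∈ Q + 1 with E(f_η) ≤ 2m².
-- If some η ∈ Q + 1 is not in Q, then f_η is injective on A × A.  Otherwise
-- Q + 1 ⊆ Q, and as 0 ∈ Q this forces Q + 1 = 𝔽_p; averaging E(f_η) over the
-- slopes η ≠ 0 then gives E(f_η) ≤ 2m² once (m - 1)² ≤ p - 1.  Taking
-- m = min(|A|, ⌈√p⌉) gives m² ≥ min(|A|², p).

open import Data.Nat.Base using (ℕ; zero; suc; NonZero)
open import Data.Nat.Primality using (Prime)
open import Data.Fin.Subset using (Subset)
open import Relation.Binary.Definitions using (DecidableEquality)

module FiniteSums where
  open import Data.Nat
  open import Data.Nat.Properties
  open import Data.Nat.Tactic.RingSolver using (solve-∀)
  open import Data.List using (List; []; _∷_; length; map; _++_; cartesianProduct)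
  open import Data.List.Properties using (length-++; length-map)
  open import Data.List.Membership.Propositional using (_∈_)
  open import Data.List.Relation.Unary.Any using (here; there)
  open import Data.List.Relation.Unary.All using (lookup)
  open import Data.List.Relation.Unary.AllPairs using (_∷_)
  open import Data.List.Relation.Unary.Unique.Propositional using (Unique)
  open import Data.Product using (∃; _×_; _,_)
  open import Function using (_∘_)
  open import Relation.Nullary using (Dec; yes; no; ¬_; ¬?; contradiction)
  open import Relation.Binary.PropositionalEquality

  ∑ : {X : Set} → List X → (X → ℕ) → ℕ
  ∑ []      h = 0
  ∑ (x ∷ L) h = h x + ∑ L h

  syntax ∑ L (λ x → h) = ∑[ x ∈ L ] h

  𝟙 : {P : Set} → Dec P → ℕ
  𝟙 (yes _) = 1
  𝟙 (no _)  = 0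

  𝟙≤1 : {P : Set} (d : Dec P) → 𝟙 d ≤ 1
  𝟙≤1 (yes _) = ≤-refl
  𝟙≤1 (no _)  = z≤n

  𝟙-true : {P : Set} (d : Dec P) → P → 𝟙 d ≡ 1
  𝟙-true (yes _) _  = refl
  𝟙-true (no ¬p) p = contradiction p ¬p

  𝟙-false : {P : Set} (d : Dec P) → ¬ P → 𝟙 d ≡ 0
  𝟙-false (yes p) ¬p = contradiction p ¬p
  𝟙-false (no _)  _  = refl

  𝟙-complement : {P : Set} (d : Dec P) → 𝟙 d + 𝟙 (¬? d) ≡ 1
  𝟙-complement (yes _) = refl
  𝟙-complement (no _)  = refl

  module _ {X : Set} where

    ∑-cong : (L : List X) {f h : X → ℕ} → (∀ {x} → x ∈ L → f x ≡ h x) → ∑ L f ≡ ∑ L h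
    ∑-cong []      e = refl
    ∑-cong (x ∷ L) e = cong₂ _+_ (e (here refl)) (∑-cong L (e ∘ there))

    ∑-mono : (L : List X) {f h : X → ℕ} → (∀ {x} → x ∈ L → f x ≤ h x) → ∑ L f ≤ ∑ L h
    ∑-mono []      e = z≤n
    ∑-mono (x ∷ L) e = +-mono-≤ (e (here refl)) (∑-mono L (e ∘ there))

    ∑-+ : (L : List X) (f h : X → ℕ) → ∑[ x ∈ L ] (f x + h x) ≡ ∑ L f + ∑ L h
    ∑-+ []      f h = refl
    ∑-+ (x ∷ L) f h = trans (cong (f x + h x +_) (∑-+ L f h)) (interchange (f x) (h x) _ _)
      where interchange : ∀ a b c d → (a + b) + (c + d) ≡ (a + c) + (b + d)
            interchange = solve-∀

    ∑-const : (L : List X) (c : ℕ) → ∑[ x ∈ L ] c ≡ length L * c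
    ∑-const []      c = refl
    ∑-const (x ∷ L) c = cong (c +_) (∑-const L c)

    ∑-*ˡ : (L : List X) (c : ℕ) (f : X → ℕ) → ∑[ x ∈ L ] (c * f x) ≡ c * ∑ L f
    ∑-*ˡ []      c f = sym (*-zeroʳ c)
    ∑-*ˡ (x ∷ L) c f = trans (cong (c * f x +_) (∑-*ˡ L c f)) (sym (*-distribˡ-+ c (f x) _))

    term≤∑ : (L : List X) (h : X → ℕ) {x : X} → x ∈ L → h x ≤ ∑ L h
    term≤∑ (y ∷ L) h (here refl) = m≤m+n _ _
    term≤∑ (y ∷ L) h (there x∈L) = ≤-trans (term≤∑ L h x∈L) (m≤n+m _ _)

    below-average : (L : List X) (h : X → ℕ) → 1 ≤ length L →
                    ∃ λ x → x ∈ L × length L * h x ≤ ∑ L h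
    below-average (x ∷ [])    h _ = x , here refl , ≤-refl
    below-average (x ∷ y ∷ L) h _ with below-average (y ∷ L) h (s≤s z≤n)
    ... | z , z∈L , avg with h x ≤? h z
    ...   | yes hx≤hz = x , here refl , +-monoʳ-≤ (h x) (≤-trans (*-monoʳ-≤ (length (y ∷ L)) hx≤hz) avg)
    ...   | no  hx≰hz = z , there z∈L , +-mono-≤ (<⇒≤ (≰⇒> hx≰hz)) avg

    ∑-vanishes : (L : List X) (h : X → ℕ) → (∀ {x} → x ∈ L → h x ≡ 0) → ∑ L h ≡ 0
    ∑-vanishes L h e = trans (∑-cong L e) (trans (∑-const L 0) (*-zeroʳ (length L)))

    count-unique≤1 : (L : List X) {P : X → Set} (P? : ∀ x → Dec (P x)) → Unique L →
                     (∀ {y z} → y ∈ L → z ∈ L → P y → P z → y ≡ z) → ∑[ x ∈ L ] 𝟙 (P? x) ≤ 1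
    count-unique≤1 []      P? _           _   = z≤n
    count-unique≤1 (x ∷ L) P? (x∉L ∷ uL) one with P? x
    ... | no _  = count-unique≤1 L P? uL (λ y∈ z∈ → one (there y∈) (there z∈))
    ... | yes px = ≤-reflexive (cong suc (∑-vanishes L _ λ {z} z∈L →
                     𝟙-false (P? z) λ pz → lookup x∉L z∈L (one (here refl) (there z∈L) px pz)))

    count-others : (_≟_ : DecidableEquality X) (L : List X) {x : X} → x ∈ L →
                   ∑[ x' ∈ L ] 𝟙 (¬? (x ≟ x')) ≤ length L ∸ 1
    count-others _≟_ L {x} x∈L = begin
      others                   ≡⟨ m+n∸m≡n same others ⟨
      (same + others) ∸ same   ≤⟨ ∸-monoʳ-≤ (same + others) at-least-x ⟩
      (same + others) ∸ 1      ≡⟨ cong (_∸ 1) total ⟩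
      length L ∸ 1             ∎
      where
      open ≤-Reasoning
      same others : ℕ
      same  = ∑[ x' ∈ L ] 𝟙 (x ≟ x')
      others = ∑[ x' ∈ L ] 𝟙 (¬? (x ≟ x'))
      at-least-x : 1 ≤ same
      at-least-x = subst (_≤ same) (𝟙-true (x ≟ x) refl) (term≤∑ L (λ x' → 𝟙 (x ≟ x')) x∈L)
      total : same + others ≡ length L
      total = begin-equality
        same + others                               ≡⟨ ∑-+ L _ _ ⟨
        ∑[ x' ∈ L ] (𝟙 (x ≟ x') + 𝟙 (¬? (x ≟ x'))) ≡⟨ ∑-cong L (λ {x'} _ → 𝟙-complement (x ≟ x')) ⟩
        ∑[ x' ∈ L ] 1                               ≡⟨ ∑-const L 1 ⟩
        length L * 1                                ≡⟨ *-identityʳ _ ⟩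
        length L                                    ∎

  module _ {X Y : Set} where

    ∑-swap : (L : List X) (M : List Y) (h : X → Y → ℕ) →
             ∑[ x ∈ L ] ∑[ y ∈ M ] h x y ≡ ∑[ y ∈ M ] ∑[ x ∈ L ] h x y
    ∑-swap []      M h = sym (trans (∑-const M 0) (*-zeroʳ (length M)))
    ∑-swap (x ∷ L) M h = trans (cong (∑ M (h x) +_) (∑-swap L M h))
                               (sym (∑-+ M (h x) (λ y → ∑[ x ∈ L ] h x y)))

    ∑-cartesian : (L : List X) (M : List Y) (h : X × Y → ℕ) →
                  ∑ (cartesianProduct L M) h ≡ ∑[ x ∈ L ] ∑[ y ∈ M ] h (x , y)
    ∑-cartesian []      M h = refl
    ∑-cartesian (x ∷ L) M h = trans (∑-++ (map (x ,_) M)) (cong₂ _+_ (∑-map M) (∑-cartesian L M h))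
      where
      ∑-++ : ∀ A {B} → ∑ (A ++ B) h ≡ ∑ A h + ∑ B h
      ∑-++ []      = refl
      ∑-++ (a ∷ A) = trans (cong (h a +_) (∑-++ A)) (sym (+-assoc (h a) _ _))
      ∑-map : ∀ N → ∑ (map (x ,_) N) h ≡ ∑[ y ∈ N ] h (x , y)
      ∑-map []      = refl
      ∑-map (y ∷ N) = cong (h (x , y) +_) (∑-map N)

    length-cartesian : (L : List X) (M : List Y) → length (cartesianProduct L M) ≡ length L * length M
    length-cartesian []      M = refl
    length-cartesian (x ∷ L) M = trans (length-++ (map (x ,_) M))
                                       (cong₂ _+_ (length-map (x ,_) M) (length-cartesian L M))

    ∑-product : (L : List X) (M : List Y) (f : X → ℕ) (h : Y → ℕ) →
                ∑ (cartesianProduct L M) (λ (x , y) → f x * h y) ≡ ∑ L f * ∑ M h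
    ∑-product L M f h = begin
      ∑ (cartesianProduct L M) (λ (x , y) → f x * h y) ≡⟨ ∑-cartesian L M _ ⟩
      ∑[ x ∈ L ] ∑[ y ∈ M ] (f x * h y)               ≡⟨ ∑-cong L (λ {x} _ → ∑-*ˡ M (f x) h) ⟩
      ∑[ x ∈ L ] (f x * ∑ M h)                         ≡⟨ ∑-cong L (λ {x} _ → *-comm (f x) _) ⟩
      ∑[ x ∈ L ] (∑ M h * f x)                         ≡⟨ ∑-*ˡ L (∑ M h) f ⟩
      ∑ M h * ∑ L f                                    ≡⟨ *-comm (∑ M h) _ ⟩
      ∑ L f * ∑ M h                                    ∎
      where open ≡-Reasoning

module Energy {X Y : Set} (_≟_ : DecidableEquality Y) where
  open import Data.Nat hiding (_≟_)
  open import Data.Nat.Properties hiding (_≟_)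
  open import Data.Nat.Tactic.RingSolver using (solve-∀)
  open import Data.List using (List; []; _∷_; length)
  open import Data.List.Membership.Propositional using (_∈_)
  open import Data.List.Relation.Unary.Any using (here; there)
  import Data.List.Relation.Unary.All as All
  open import Data.List.Relation.Unary.AllPairs using ([]; _∷_)
  open import Data.List.Relation.Unary.Unique.Propositional using (Unique)
  open import Data.Product using (∃; _×_; _,_)
  open import Relation.Nullary using (yes; no; ¬_)
  open import Relation.Binary.PropositionalEquality
  open FiniteSums

  energy : (X → Y) → List X → ℕ
  energy g S = ∑[ s ∈ S ] ∑[ s' ∈ S ] 𝟙 (g s ≟ g s')

  energy-mono : (g h : X → Y) (S : List X) → (∀ s s' → g s ≡ g s' → h s ≡ h s') →
                energy g S ≤ energy h S
  energy-mono g h S refine = ∑-mono S λ {s} _ → ∑-mono S λ {s'} _ → indicator≤ s s'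
    where
    indicator≤ : ∀ s s' → 𝟙 (g s ≟ g s') ≤ 𝟙 (h s ≟ h s')
    indicator≤ s s' with g s ≟ g s'
    ... | no  _ = z≤n
    ... | yes e = ≤-reflexive (sym (𝟙-true (h s ≟ h s') (refine s s' e)))

  energy-injective : (g : X → Y) (S : List X) → Unique S →
                     (∀ {s s'} → s ∈ S → s' ∈ S → g s ≡ g s' → s ≡ s') → energy g S ≤ length S
  energy-injective g S uS inj = begin
    energy g S          ≤⟨ ∑-mono S (λ s∈ → count-unique≤1 S (λ s' → g _ ≟ g s') uS
                             λ y∈ z∈ gy gz → trans (sym (inj s∈ y∈ gy)) (inj s∈ z∈ gz)) ⟩
    ∑[ s ∈ S ] 1        ≡⟨ ∑-const S 1 ⟩
    length S * 1        ≡⟨ *-identityʳ _ ⟩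
    length S            ∎
    where open ≤-Reasoning

  agreements : (X → Y) → X → List X → ℕ
  agreements g s S = ∑[ s' ∈ S ] 𝟙 (g s ≟ g s')

  -- Adding s to S adds the pair (s , s) and, symmetrically, its agreements.
  energy-∷ : (g : X → Y) (s : X) (S : List X) →
             energy g (s ∷ S) ≡ 1 + 2 * agreements g s S + energy g S
  energy-∷ g s S = begin
    (𝟙 (g s ≟ g s) + a) + ∑[ s' ∈ S ] (𝟙 (g s' ≟ g s) + ∑[ t ∈ S ] 𝟙 (g s' ≟ g t))
      ≡⟨ cong₂ (λ d r → (d + a) + r) (𝟙-true (g s ≟ g s) refl) (∑-+ S _ _) ⟩
    (1 + a) + (∑[ s' ∈ S ] 𝟙 (g s' ≟ g s) + energy g S)
      ≡⟨ cong (λ b → (1 + a) + (b + energy g S)) (∑-cong S λ {s'} _ → symmetric (g s') (g s)) ⟩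
    (1 + a) + (a + energy g S)
      ≡⟨ arithmetic a (energy g S) ⟩
    1 + 2 * a + energy g S ∎
    where
    open ≡-Reasoning
    a = agreements g s S
    symmetric : ∀ u v → 𝟙 (u ≟ v) ≡ 𝟙 (v ≟ u)
    symmetric u v with u ≟ v
    ... | yes e = sym (𝟙-true (v ≟ u) (sym e))
    ... | no ne = sym (𝟙-false (v ≟ u) (λ e → ne (sym e)))
    arithmetic : ∀ a e → (1 + a) + (a + e) ≡ 1 + 2 * a + e
    arithmetic = solve-∀

  LargeImage : (X → Y) → List X → Set
  LargeImage g S = ∃ λ U → Unique U × (∀ {u} → u ∈ U → ∃ λ s → s ∈ S × g s ≡ u) ×
                           3 * length S ≤ 2 * length U + energy g S

  -- Image bound: every g has a large image on every S.
  -- (A value taken k times contributes k² ≥ 3k - 2 to the energy.)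
  image-bound : (g : X → Y) (S : List X) → LargeImage g S
  image-bound g []      = [] , [] , (λ ()) , z≤n
  image-bound g (s ∷ S) with image-bound g S
  ... | U , uU , U⊆gS , bound = extend (agreements g s S) refl
    where
    open ≤-Reasoning
    U⊆gsS : ∀ {u} → u ∈ U → ∃ λ t → t ∈ s ∷ S × g t ≡ u
    U⊆gsS u∈U with U⊆gS u∈U
    ... | t , t∈S , gt≡u = t , there t∈S , gt≡u
    energy-grows : ∀ {a} → agreements g s S ≡ a → energy g (s ∷ S) ≡ 1 + 2 * a + energy g S
    energy-grows eq = trans (energy-∷ g s S) (cong (λ a → 1 + 2 * a + energy g S) eq)

    extend : ∀ a → agreements g s S ≡ a → LargeImage g (s ∷ S)
    -- g s is a new value: the image grows by one.
    extend zero eq = g s ∷ U , All.tabulate fresh ∷ uU , ⊆gS , (begin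
      3 * suc (length S)                            ≡⟨ *-suc 3 (length S) ⟩
      3 + 3 * length S                              ≤⟨ +-monoʳ-≤ 3 bound ⟩
      3 + (2 * length U + energy g S)               ≡⟨ new-value (length U) (energy g S) ⟩
      2 * suc (length U) + (1 + 2 * 0 + energy g S) ≡⟨ cong (2 * suc (length U) +_) (energy-grows eq) ⟨
      2 * suc (length U) + energy g (s ∷ S)         ∎)
      where
      new-value : ∀ u e → 3 + (2 * u + e) ≡ 2 * suc u + (1 + 2 * 0 + e)
      new-value = solve-∀
      fresh : ∀ {u} → u ∈ U → g s ≢ u
      fresh u∈U gs≡u with U⊆gS u∈U
      ... | t , t∈S , gt≡u = 1≰0 (begin
        1                ≡⟨ 𝟙-true (g s ≟ g t) (trans gs≡u (sym gt≡u)) ⟨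
        𝟙 (g s ≟ g t)    ≤⟨ term≤∑ S (λ t → 𝟙 (g s ≟ g t)) t∈S ⟩
        agreements g s S ≡⟨ eq ⟩
        0                ∎)
        where 1≰0 : ¬ (1 ≤ 0)
              1≰0 ()
      ⊆gS : ∀ {u} → u ∈ g s ∷ U → ∃ λ t → t ∈ s ∷ S × g t ≡ u
      ⊆gS (here refl) = s , here refl , refl
      ⊆gS (there u∈U) = U⊆gsS u∈U
    -- g s repeats a value: the energy grows by at least three.
    extend (suc k) eq = U , uU , U⊆gsS , (begin
      3 * suc (length S)                          ≡⟨ *-suc 3 (length S) ⟩
      3 + 3 * length S                            ≤⟨ +-monoʳ-≤ 3 bound ⟩
      3 + (2 * length U + energy g S)             ≤⟨ m≤n+m _ (2 * k) ⟩
      2 * k + (3 + (2 * length U + energy g S))   ≡⟨ repeated-value k (length U) (energy g S) ⟩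
      2 * length U + (1 + 2 * suc k + energy g S) ≡⟨ cong (2 * length U +_) (energy-grows eq) ⟨
      2 * length U + energy g (s ∷ S)             ∎)
      where
      repeated-value : ∀ k u e → 2 * k + (3 + (2 * u + e)) ≡ 2 * u + (1 + 2 * suc k + e)
      repeated-value = solve-∀

module SubsetLists where
  open import Data.Nat
  open import Data.Nat.Properties using (≤-trans)
  open import Data.Fin using (Fin; zero; suc)
  open import Data.Fin.Properties using (suc-injective)
  open import Data.Fin.Subset using (Subset; inside; outside; ∣_∣; _-_) renaming (_∈_ to _∈ₛ_)
  open import Data.Fin.Subset.Properties using (x∈p⇒∣p-x∣<∣p∣; x∈p∧x≢y⇒x∈p-y)
  open import Data.Vec using ([]; _∷_; here; there)
  open import Data.List using (List; []; _∷_; length; map)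
  open import Data.List.Properties using (length-map)
  open import Data.List.Membership.Propositional using (_∈_)
  open import Data.List.Membership.Propositional.Properties using (∈-map⁻)
  import Data.List.Relation.Unary.Any as Any
  open import Data.List.Relation.Unary.All using (lookup; tabulate)
  open import Data.List.Relation.Unary.AllPairs using ([]; _∷_)
  open import Data.List.Relation.Unary.Unique.Propositional using (Unique)
  import Data.List.Relation.Unary.Unique.Propositional.Properties as Unique
  open import Data.Product using (Σ; _×_; _,_)
  open import Relation.Binary.PropositionalEquality

  length≤∣∣ : ∀ {n} (U : List (Fin n)) (T : Subset n) → Unique U →
              (∀ {u} → u ∈ U → u ∈ₛ T) → length U ≤ ∣ T ∣
  length≤∣∣ []      T _          _    = z≤n
  length≤∣∣ (u ∷ U) T (u∉U ∷ uU) U⊆T = ≤-trans (s≤s (length≤∣∣ U (T - u) uU U⊆T-u))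
                                                (x∈p⇒∣p-x∣<∣p∣ (U⊆T (Any.here refl)))
    where
    U⊆T-u : ∀ {v} → v ∈ U → v ∈ₛ T - u
    U⊆T-u v∈U = x∈p∧x≢y⇒x∈p-y (U⊆T (Any.there v∈U)) (λ v≡u → lookup u∉U v∈U (sym v≡u))

  Enumeration : ∀ {n} → Subset n → Set
  Enumeration {n} A = Σ (List (Fin n)) λ L → Unique L × (∀ {x} → x ∈ L → x ∈ₛ A) × length L ≡ ∣ A ∣

  map-suc⊆ : ∀ {n b} {A : Subset n} {L} → (∀ {x} → x ∈ L → x ∈ₛ A) →
             ∀ {x} → x ∈ map suc L → x ∈ₛ (b ∷ A)
  map-suc⊆ L⊆A x∈ with ∈-map⁻ suc x∈
  ... | y , y∈L , refl = there (L⊆A y∈L)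

  enumerate : ∀ {n} (A : Subset n) → Enumeration A
  enumerate []            = [] , [] , (λ ()) , refl
  enumerate (outside ∷ A) with enumerate A
  ... | L , uL , L⊆A , len = map suc L , Unique.map⁺ suc-injective uL , map-suc⊆ L⊆A ,
                              trans (length-map suc L) len
  enumerate (inside ∷ A)  with enumerate A
  ... | L , uL , L⊆A , len = zero ∷ map suc L , tabulate zero∉ ∷ Unique.map⁺ suc-injective uL ,
                              (λ { (Any.here refl) → here ; (Any.there x∈) → map-suc⊆ L⊆A x∈ }) ,
                              cong suc (trans (length-map suc L) len)
    where
    zero∉ : ∀ {x} → x ∈ map suc L → zero ≢ x
    zero∉ x∈ refl with ∈-map⁻ suc x∈
    ... | _ , _ , ()

-- Every operation of 𝔽 is compatible with ⟦_⟧ modulo p, and ⟦_⟧ is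
-- injective modulo p, so equations in 𝔽_p are proved by ring identities
-- in ℤ.
module Residues (n : ℕ) where
  open import Defs
  open import Data.Nat as ℕ using (ℕ; suc)
  import Data.Nat.Properties as ℕ
  open import Data.Nat.DivMod using (_mod_; _%_; _/_; m≡m%n+[m/n]*n; m%n<n)
  import Data.Nat.Divisibility as ℕ
  open import Data.Fin using (Fin; zero; toℕ)
  open import Data.Fin.Properties using (toℕ-fromℕ<; toℕ<n; toℕ-injective)
  open import Data.Integer using (ℤ; +_; _+_; _*_; _-_; -_; ∣_∣)
  import Data.Integer.Properties as ℤ
  open import Data.Integer.Divisibility.Signed using (_∣_; ∣ᵤ⇒∣; ∣⇒∣ᵤ; ∣-refl)
  open import Data.Integer.Divisibility.Signed using (∣m⇒∣-m; ∣m∣n⇒∣m+n; ∣m∣n⇒∣m-n; ∣n⇒∣m*n)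
  open import Data.Integer.Tactic.RingSolver using (solve-∀)
  open import Relation.Binary.Bundles using (Setoid)
  import Relation.Binary.Reasoning.Setoid as SetoidReasoning
  open import Relation.Binary.PropositionalEquality
  open import Relation.Nullary using (contradiction)

  p : ℕ
  p = suc n

  open 𝔽 (suc n) public

  ⟦_⟧ : Fin p → ℤ
  ⟦ x ⟧ = + toℕ x

  infix 4 _≋_
  record _≋_ (a b : ℤ) : Set where
    constructor by-divisibility
    field divides : + p ∣ a - b
  open _≋_ public

  ≋-by : ∀ {a b d} → + p ∣ d → d ≡ a - b → a ≋ b
  ≋-by p∣d refl = by-divisibility p∣d

  ≋-reflexive : ∀ {a b} → a ≡ b → a ≋ b
  ≋-reflexive {a} refl = ≋-by (∣ᵤ⇒∣ (ℕ.divides 0 refl)) (sym (ℤ.+-inverseʳ a))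

  ≋-refl : ∀ {a} → a ≋ a
  ≋-refl = ≋-reflexive refl

  ≋-sym : ∀ {a b} → a ≋ b → b ≋ a
  ≋-sym {a} {b} (by-divisibility p∣a-b) =
    ≋-by (∣m⇒∣-m p∣a-b) (identity a b)
    where identity : ∀ a b → - (a - b) ≡ b - a
          identity = solve-∀

  ≋-trans : ∀ {a b c} → a ≋ b → b ≋ c → a ≋ c
  ≋-trans {a} {b} {c} (by-divisibility p∣a-b) (by-divisibility p∣b-c) =
    ≋-by (∣m∣n⇒∣m+n p∣a-b p∣b-c) (identity a b c)
    where identity : ∀ a b c → (a - b) + (b - c) ≡ a - c
          identity = solve-∀

  ≋-setoid : Setoid _ _
  ≋-setoid = record
    { Carrier = ℤ ; _≈_ = _≋_
    ; isEquivalence = record { refl = ≋-refl ; sym = ≋-sym ; trans = ≋-trans } }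

  module ≋-Reasoning = SetoidReasoning ≋-setoid

  +-≋ : ∀ {a b c d} → a ≋ b → c ≋ d → a + c ≋ b + d
  +-≋ {a} {b} {c} {d} (by-divisibility p∣a-b) (by-divisibility p∣c-d) =
    ≋-by (∣m∣n⇒∣m+n p∣a-b p∣c-d) (identity a b c d)
    where identity : ∀ a b c d → (a - b) + (c - d) ≡ (a + c) - (b + d)
          identity = solve-∀

  -‿≋ : ∀ {a b c d} → a ≋ b → c ≋ d → a - c ≋ b - d
  -‿≋ {a} {b} {c} {d} (by-divisibility p∣a-b) (by-divisibility p∣c-d) =
    ≋-by (∣m∣n⇒∣m-n p∣a-b p∣c-d) (identity a b c d)
    where identity : ∀ a b c d → (a - b) - (c - d) ≡ (a - c) - (b - d)
          identity = solve-∀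

  *-≋ : ∀ {a b c d} → a ≋ b → c ≋ d → a * c ≋ b * d
  *-≋ {a} {b} {c} {d} (by-divisibility p∣a-b) (by-divisibility p∣c-d) =
    ≋-by (∣m∣n⇒∣m+n (∣n⇒∣m*n c p∣a-b) (∣n⇒∣m*n b p∣c-d)) (identity a b c d)
    where identity : ∀ a b c d → c * (a - b) + b * (c - d) ≡ a * c - b * d
          identity = solve-∀

  residue : ∀ m → ⟦ m mod p ⟧ ≋ + m
  residue m = ≋-by (∣n⇒∣m*n (- + (m / p)) ∣-refl) (begin
    - + (m / p) * + p                           ≡⟨ identity (+ (m % p)) (+ (m / p)) (+ p) ⟩
    + (m % p) - (+ (m % p) + + (m / p) * + p)    ≡⟨ cong₂ (λ r s → r - s) (cong +_ (sym toℕ-residue)) (sym division) ⟩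
    ⟦ m mod p ⟧ - + m                            ∎)
    where
    open ≡-Reasoning
    toℕ-residue : toℕ (m mod p) ≡ m % p
    toℕ-residue = toℕ-fromℕ< (m%n<n m p)
    division : + m ≡ + (m % p) + + (m / p) * + p
    division = trans (cong +_ (m≡m%n+[m/n]*n m p))
                     (trans (ℤ.pos-+ (m % p) _) (cong (λ t → + (m % p) + t) (ℤ.pos-* (m / p) p)))
    identity : ∀ r q P → - q * P ≡ r - (r + q * P)
    identity = solve-∀

  ⟦+⟧ : ∀ x y → ⟦ x +F y ⟧ ≋ ⟦ x ⟧ + ⟦ y ⟧
  ⟦+⟧ x y = ≋-trans (residue _) (≋-reflexive (ℤ.pos-+ (toℕ x) (toℕ y)))

  ⟦*⟧ : ∀ x y → ⟦ x *F y ⟧ ≋ ⟦ x ⟧ * ⟦ y ⟧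
  ⟦*⟧ x y = ≋-trans (residue _) (≋-reflexive (ℤ.pos-* (toℕ x) (toℕ y)))

  ⟦-⟧ : ∀ x y → ⟦ x -F y ⟧ ≋ ⟦ x ⟧ - ⟦ y ⟧
  ⟦-⟧ x y = ≋-trans (residue _) (≋-by ∣-refl (begin
    + p                                    ≡⟨ identity ⟦ x ⟧ ⟦ y ⟧ (+ p) ⟩
    (⟦ x ⟧ + (+ p - ⟦ y ⟧)) - (⟦ x ⟧ - ⟦ y ⟧) ≡⟨ cong (_- (⟦ x ⟧ - ⟦ y ⟧)) (sym expand) ⟩
    + (toℕ x ℕ.+ (p ℕ.∸ toℕ y)) - (⟦ x ⟧ - ⟦ y ⟧) ∎))
    where
    open ≡-Reasoning
    identity : ∀ X Y P → P ≡ (X + (P - Y)) - (X - Y)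
    identity = solve-∀
    expand : + (toℕ x ℕ.+ (p ℕ.∸ toℕ y)) ≡ ⟦ x ⟧ + (+ p - ⟦ y ⟧)
    expand = trans (ℤ.pos-+ (toℕ x) _)
                   (cong (λ t → ⟦ x ⟧ + t) (trans (sym (ℤ.⊖-≥ (ℕ.<⇒≤ (toℕ<n y))))
                                                  (sym (ℤ.m-n≡m⊖n p (toℕ y)))))

  ⟦⟧-injective : ∀ {x y} → ⟦ x ⟧ ≋ ⟦ y ⟧ → x ≡ y
  ⟦⟧-injective {x} {y} (by-divisibility p∣x-y) =
    toℕ-injective (ℤ.+-injective (ℤ.i-j≡0⇒i≡j ⟦ x ⟧ ⟦ y ⟧ (ℤ.∣i∣≡0⇒i≡0 (small-multiple (∣⇒∣ᵤ p∣x-y)))))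
    where
    distance<p : ∣ ⟦ x ⟧ - ⟦ y ⟧ ∣ ℕ.< p
    distance<p = ℕ.≤-<-trans (ℕ.≤-reflexive (cong ∣_∣ (ℤ.m-n≡m⊖n (toℕ x) (toℕ y))))
                   (ℕ.≤-<-trans (ℤ.∣m⊝n∣≤m⊔n (toℕ x) (toℕ y)) (ℕ.⊔-lub (toℕ<n x) (toℕ<n y)))
    small-multiple : p ℕ.∣ ∣ ⟦ x ⟧ - ⟦ y ⟧ ∣ → ∣ ⟦ x ⟧ - ⟦ y ⟧ ∣ ≡ 0
    small-multiple p∣d with ∣ ⟦ x ⟧ - ⟦ y ⟧ ∣ | distance<p
    ... | 0     | _ = refl
    ... | suc d | d<p = contradiction (ℕ.∣⇒≤ p∣d) (ℕ.<⇒≱ d<p)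

  ≋⇒difference : ∀ {a b} → a ≋ b → a - b ≋ + 0
  ≋⇒difference {a} {b} (by-divisibility p∣a-b) = ≋-by p∣a-b (sym (ℤ.+-identityʳ (a - b)))

  difference⇒≡ : ∀ {x y} → ⟦ x ⟧ - ⟦ y ⟧ ≋ + 0 → x ≡ y
  difference⇒≡ {x} {y} (by-divisibility p∣d) =
    ⟦⟧-injective (by-divisibility (subst (+ p ∣_) (ℤ.+-identityʳ (⟦ x ⟧ - ⟦ y ⟧)) p∣d))

  one : Fin p
  one = 1 mod p

  -- 𝔽_p is generated by one under addition: an additively closed
  -- property of zero holds everywhere.
  additive-induction : (R : Fin p → Set) → R zero → (∀ η → R η → R (η +F one)) → ∀ η → R η
  additive-induction R R0 step η = subst R (⟦⟧-injective (residue (toℕ η))) (multiple (toℕ η))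
    where
    successor : ∀ k → (k mod p) +F one ≡ suc k mod p
    successor k = ⟦⟧-injective (begin
      ⟦ (k mod p) +F one ⟧       ≈⟨ ⟦+⟧ (k mod p) one ⟩
      ⟦ k mod p ⟧ + ⟦ one ⟧      ≈⟨ +-≋ (residue k) (residue 1) ⟩
      + k + + 1                  ≡⟨ ℤ.pos-+ k 1 ⟨
      + (k ℕ.+ 1)                ≡⟨ cong +_ (ℕ.+-comm k 1) ⟩
      + suc k                    ≈⟨ ≋-sym (residue (suc k)) ⟩
      ⟦ suc k mod p ⟧            ∎)
      where open ≋-Reasoning
    multiple : ∀ k → R (k mod p)
    multiple ℕ.zero    = R0
    multiple (suc k) = subst R (successor k) (step (k mod p) (multiple k))

  self-difference : ∀ a → a -F a ≡ zero
  self-difference a = difference⇒≡ (begin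
    ⟦ a -F a ⟧ - + 0          ≡⟨ ℤ.+-identityʳ _ ⟩
    ⟦ a -F a ⟧                ≈⟨ ⟦-⟧ a a ⟩
    ⟦ a ⟧ - ⟦ a ⟧             ≡⟨ ℤ.+-inverseʳ ⟦ a ⟧ ⟩
    + 0                       ∎)
    where open ≋-Reasoning

  successor-multiple : ∀ η w r → η *F w ≡ r → (η +F one) *F w ≡ r +F w
  successor-multiple η w r ηw≡r = ⟦⟧-injective (begin
    ⟦ (η +F one) *F w ⟧          ≈⟨ ≋-trans (⟦*⟧ (η +F one) w) (*-≋ (⟦+⟧ η one) (≋-refl {⟦ w ⟧})) ⟩
    (⟦ η ⟧ + ⟦ one ⟧) * ⟦ w ⟧    ≈⟨ *-≋ (+-≋ (≋-refl {⟦ η ⟧}) (residue 1)) (≋-refl {⟦ w ⟧}) ⟩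
    (⟦ η ⟧ + + 1) * ⟦ w ⟧        ≡⟨ identity ⟦ η ⟧ ⟦ w ⟧ ⟩
    ⟦ η ⟧ * ⟦ w ⟧ + ⟦ w ⟧        ≈⟨ +-≋ (≋-trans (≋-sym (⟦*⟧ η w)) (≋-reflexive (cong ⟦_⟧ ηw≡r)))
                                       (≋-refl {⟦ w ⟧}) ⟩
    ⟦ r ⟧ + ⟦ w ⟧                ≈⟨ ≋-sym (⟦+⟧ r w) ⟩
    ⟦ r +F w ⟧                   ∎)
    where
    open ≋-Reasoning
    identity : ∀ E W → (E + + 1) * W ≡ E * W + W
    identity = solve-∀

  minus-plus : ∀ η u → (η -F u) +F u ≡ η
  minus-plus η u = ⟦⟧-injective (begin
    ⟦ (η -F u) +F u ⟧           ≈⟨ ≋-trans (⟦+⟧ (η -F u) u) (+-≋ (⟦-⟧ η u) (≋-refl {⟦ u ⟧})) ⟩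
    (⟦ η ⟧ - ⟦ u ⟧) + ⟦ u ⟧     ≡⟨ identity ⟦ η ⟧ ⟦ u ⟧ ⟩
    ⟦ η ⟧                       ∎)
    where
    open ≋-Reasoning
    identity : ∀ E U → (E - U) + U ≡ E
    identity = solve-∀

module Forms (p : ℕ) .{{_ : NonZero p}} where
  open import Defs
  open import Data.Fin using (Fin)
  open import Data.Fin.Properties using (_≟_; any?)
  open import Data.Fin.Subset using (Subset; _∈_)
  open import Data.Fin.Subset.Properties using (_∈?_)
  open import Data.Vec.Properties using (lookup⇒[]=; lookup∘tabulate)
  open import Data.Product using (∃; _×_; _,_)
  open import Relation.Nullary using (Dec; does)
  open import Relation.Nullary.Decidable using (dec-true; _×-dec_)
  open import Relation.Binary.PropositionalEquality using (_≡_; refl; trans)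

  open 𝔽 p

  setOp-∈ : ∀ (_⊙_ : Fin p → Fin p → Fin p) {X Y x y} → x ∈ X → y ∈ Y → (x ⊙ y) ∈ setOp _⊙_ X Y
  setOp-∈ _⊙_ {X} {Y} {x} {y} x∈X y∈Y =
    lookup⇒[]= (x ⊙ y) (setOp _⊙_ X Y)
      (trans (lookup∘tabulate (λ z → does (witness? z)) (x ⊙ y))
             (dec-true (witness? (x ⊙ y)) (x , y , x∈X , y∈Y , refl)))
    where
    witness? : ∀ z → Dec (∃ λ x → ∃ λ y → x ∈ X × y ∈ Y × z ≡ x ⊙ y)
    witness? z = any? λ x → any? λ y → (x ∈? X) ×-dec ((y ∈? Y) ×-dec (z ≟ (x ⊙ y)))

  triple : (u v w x y : Fin p) → Fin p
  triple u v w x y = ((u *F x) +F (v *F y)) +F (w *F y)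

  form : (a b c d : Fin p) → Fin p × Fin p → Fin p
  form a b c d (x , y) = triple c a c x y -F triple d b d x y

  form-∈ : ∀ {A : Subset p} {a b c d x y} → a ∈ A → b ∈ A → c ∈ A → d ∈ A → x ∈ A → y ∈ A →
           form a b c d (x , y) ∈ threeA²-threeA² A
  form-∈ {A} {x = x} {y} a∈ b∈ c∈ d∈ x∈ y∈ = setOp-∈ _-F_ (triple-∈ c∈ a∈ c∈) (triple-∈ d∈ b∈ d∈)
    where
    square-∈ : ∀ {u v} → u ∈ A → v ∈ A → (u *F v) ∈ (A ⊗ A)
    square-∈ = setOp-∈ _*F_
    triple-∈ : ∀ {u v w} → u ∈ A → v ∈ A → w ∈ A → triple u v w x y ∈ (((A ⊗ A) ⊕ (A ⊗ A)) ⊕ (A ⊗ A))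
    triple-∈ u∈ v∈ w∈ = setOp-∈ _+F_ (setOp-∈ _+F_ (square-∈ u∈ x∈) (square-∈ v∈ y∈)) (square-∈ w∈ y∈)

module PrimeField (n : ℕ) (prime-p : Prime (suc n)) where
  open import Data.Nat as ℕ using (ℕ; suc)
  import Data.Nat.Divisibility as ℕ
  open import Data.Nat.Primality using (euclidsLemma)
  open import Data.Fin using (Fin; zero)
  open import Data.Integer using (ℤ; +_; _+_; _*_; _-_; ∣_∣)
  import Data.Integer.Properties as ℤ
  open import Data.Integer.Divisibility.Signed using (_∣_; ∣ᵤ⇒∣; ∣⇒∣ᵤ)
  open import Data.Integer.Tactic.RingSolver using (solve-∀)
  open import Data.Product using (_×_; _,_)
  open import Data.Sum using (_⊎_; map; [_,_]′)
  open import Function using (id)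
  open import Relation.Nullary using (contradiction)
  open import Relation.Binary.PropositionalEquality hiding ([_])

  open Residues n
  open Forms (suc n) using (triple; form)

  ≋-zero : ∀ {a} → a ≋ + 0 → + p ∣ a
  ≋-zero {a} (by-divisibility p∣a-0) = subst (+ p ∣_) (ℤ.+-identityʳ a) p∣a-0

  no-zero-divisors : ∀ {u u' v v' : Fin p} → (⟦ u ⟧ - ⟦ u' ⟧) * (⟦ v ⟧ - ⟦ v' ⟧) ≋ + 0 → u ≡ u' ⊎ v ≡ v'
  no-zero-divisors {u} {u'} {v} {v'} product≋0 =
    map (λ p∣a → ⟦⟧-injective (by-divisibility (∣ᵤ⇒∣ p∣a)))
        (λ p∣b → ⟦⟧-injective (by-divisibility (∣ᵤ⇒∣ p∣b)))
        (euclidsLemma ∣ ⟦ u ⟧ - ⟦ u' ⟧ ∣ ∣ ⟦ v ⟧ - ⟦ v' ⟧ ∣ prime-p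
           (subst (p ℕ.∣_) (ℤ.abs-* (⟦ u ⟧ - ⟦ u' ⟧) _) (∣⇒∣ᵤ (≋-zero product≋0))))

  line : Fin p → Fin p × Fin p → Fin p
  line η (x , y) = x +F (η *F y)

  ⟦line⟧ : ∀ η x y → ⟦ line η (x , y) ⟧ ≋ ⟦ x ⟧ + ⟦ η ⟧ * ⟦ y ⟧
  ⟦line⟧ η x y = ≋-trans (⟦+⟧ x (η *F y)) (+-≋ (≋-refl {⟦ x ⟧}) (⟦*⟧ η y))

  collision : ∀ η {x y x' y'} → line η (x , y) ≡ line η (x' , y') →
              (⟦ x ⟧ + ⟦ η ⟧ * ⟦ y ⟧) - (⟦ x' ⟧ + ⟦ η ⟧ * ⟦ y' ⟧) ≋ + 0
  collision η {x} {y} {x'} {y'} e = ≋⇒difference (begin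
    ⟦ x ⟧ + ⟦ η ⟧ * ⟦ y ⟧       ≈⟨ ⟦line⟧ η x y ⟨
    ⟦ line η (x , y) ⟧          ≡⟨ cong ⟦_⟧ e ⟩
    ⟦ line η (x' , y') ⟧        ≈⟨ ⟦line⟧ η x' y' ⟩
    ⟦ x' ⟧ + ⟦ η ⟧ * ⟦ y' ⟧     ∎)
    where open ≋-Reasoning

  horizontal : ∀ η {x x' y} → line η (x , y) ≡ line η (x' , y) → x ≡ x'
  horizontal η {x} {x'} {y} e =
    difference⇒≡ (≋-trans (≋-reflexive (identity ⟦ x ⟧ ⟦ x' ⟧ (⟦ η ⟧ * ⟦ y ⟧))) (collision η e))
    where identity : ∀ X X' Z → X - X' ≡ (X + Z) - (X' + Z)
          identity = solve-∀

  vertical : ∀ η {x y y'} → line η (x , y) ≡ line η (x , y') → η ≡ zero ⊎ y ≡ y'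
  vertical η {x} {y} {y'} e =
    no-zero-divisors (≋-trans (≋-reflexive (identity ⟦ x ⟧ ⟦ η ⟧ ⟦ y ⟧ ⟦ y' ⟧)) (collision η e))
    where identity : ∀ X E Y Y' → (E - + 0) * (Y - Y') ≡ (X + E * Y) - (X + E * Y')
          identity = solve-∀

  one-slope : ∀ η₁ η₂ {x y x' y'} → line η₁ (x , y) ≡ line η₁ (x' , y') →
              line η₂ (x , y) ≡ line η₂ (x' , y') → η₁ ≡ η₂ ⊎ y ≡ y'
  one-slope η₁ η₂ {x} {y} {x'} {y'} e₁ e₂ = no-zero-divisors (begin
    (⟦ η₁ ⟧ - ⟦ η₂ ⟧) * (⟦ y ⟧ - ⟦ y' ⟧)
      ≡⟨ identity ⟦ x ⟧ ⟦ y ⟧ ⟦ x' ⟧ ⟦ y' ⟧ ⟦ η₁ ⟧ ⟦ η₂ ⟧ ⟩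
    ((⟦ x ⟧ + ⟦ η₁ ⟧ * ⟦ y ⟧) - (⟦ x' ⟧ + ⟦ η₁ ⟧ * ⟦ y' ⟧)) -
    ((⟦ x ⟧ + ⟦ η₂ ⟧ * ⟦ y ⟧) - (⟦ x' ⟧ + ⟦ η₂ ⟧ * ⟦ y' ⟧))
      ≈⟨ -‿≋ (collision η₁ e₁) (collision η₂ e₂) ⟩
    + 0 ∎)
    where
    open ≋-Reasoning
    identity : ∀ X Y X' Y' E₁ E₂ →
               (E₁ - E₂) * (Y - Y') ≡ ((X + E₁ * Y) - (X' + E₁ * Y')) - ((X + E₂ * Y) - (X' + E₂ * Y'))
    identity = solve-∀

  collision-ratio : ∀ η {x y x' y'} → line η (x , y) ≡ line η (x' , y') → η *F (y' -F y) ≡ x -F x'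
  collision-ratio η {x} {y} {x'} {y'} e = difference⇒≡ (begin
    ⟦ η *F (y' -F y) ⟧ - ⟦ x -F x' ⟧
      ≈⟨ -‿≋ (≋-trans (⟦*⟧ η (y' -F y)) (*-≋ (≋-refl {⟦ η ⟧}) (⟦-⟧ y' y))) (⟦-⟧ x x') ⟩
    ⟦ η ⟧ * (⟦ y' ⟧ - ⟦ y ⟧) - (⟦ x ⟧ - ⟦ x' ⟧)
      ≡⟨ identity ⟦ x ⟧ ⟦ y ⟧ ⟦ x' ⟧ ⟦ y' ⟧ ⟦ η ⟧ ⟩
    + 0 - ((⟦ x ⟧ + ⟦ η ⟧ * ⟦ y ⟧) - (⟦ x' ⟧ + ⟦ η ⟧ * ⟦ y' ⟧))
      ≈⟨ -‿≋ (≋-refl {+ 0}) (collision η e) ⟩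
    + 0 ∎)
    where
    open ≋-Reasoning
    identity : ∀ X Y X' Y' E → E * (Y' - Y) - (X - X') ≡ + 0 - ((X + E * Y) - (X' + E * Y'))
    identity = solve-∀

  ⟦triple⟧ : ∀ u v w x y → ⟦ triple u v w x y ⟧ ≋ (⟦ u ⟧ * ⟦ x ⟧ + ⟦ v ⟧ * ⟦ y ⟧) + ⟦ w ⟧ * ⟦ y ⟧
  ⟦triple⟧ u v w x y =
    ≋-trans (⟦+⟧ ((u *F x) +F (v *F y)) (w *F y))
            (+-≋ (≋-trans (⟦+⟧ (u *F x) (v *F y)) (+-≋ (⟦*⟧ u x) (⟦*⟧ v y))) (⟦*⟧ w y))

  form-dilates-line : ∀ η a b c d → η *F (c -F d) ≡ (a -F b) +F (c -F d) →
                      ∀ x y → ⟦ form a b c d (x , y) ⟧ ≋ (⟦ c ⟧ - ⟦ d ⟧) * ⟦ line η (x , y) ⟧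
  form-dilates-line η a b c d slope x y = begin
    ⟦ form a b c d (x , y) ⟧
      ≈⟨ ≋-trans (⟦-⟧ (triple c a c x y) (triple d b d x y)) (-‿≋ (⟦triple⟧ c a c x y) (⟦triple⟧ d b d x y)) ⟩
    ((C * X + ⟦ a ⟧ * Y) + C * Y) - ((D * X + ⟦ b ⟧ * Y) + D * Y)
      ≡⟨ regroup C D ⟦ a ⟧ ⟦ b ⟧ X Y ⟩
    (C - D) * X + ((⟦ a ⟧ - ⟦ b ⟧) + (C - D)) * Y
      ≈⟨ +-≋ (≋-refl {(C - D) * X}) (*-≋ (≋-sym slope-in-ℤ) (≋-refl {Y})) ⟩
    (C - D) * X + (⟦ η ⟧ * (C - D)) * Y
      ≡⟨ factor C D ⟦ η ⟧ X Y ⟩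
    (C - D) * (X + ⟦ η ⟧ * Y)
      ≈⟨ *-≋ (≋-refl {C - D}) (≋-sym (⟦line⟧ η x y)) ⟩
    (C - D) * ⟦ line η (x , y) ⟧ ∎
    where
    open ≋-Reasoning
    C D X Y : ℤ
    C = ⟦ c ⟧
    D = ⟦ d ⟧
    X = ⟦ x ⟧
    Y = ⟦ y ⟧
    slope-in-ℤ : ⟦ η ⟧ * (C - D) ≋ (⟦ a ⟧ - ⟦ b ⟧) + (C - D)
    slope-in-ℤ = begin
      ⟦ η ⟧ * (C - D)              ≈⟨ *-≋ (≋-refl {⟦ η ⟧}) (⟦-⟧ c d) ⟨
      ⟦ η ⟧ * ⟦ c -F d ⟧           ≈⟨ ⟦*⟧ η (c -F d) ⟨
      ⟦ η *F (c -F d) ⟧            ≡⟨ cong ⟦_⟧ slope ⟩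
      ⟦ (a -F b) +F (c -F d) ⟧     ≈⟨ ≋-trans (⟦+⟧ (a -F b) (c -F d)) (+-≋ (⟦-⟧ a b) (⟦-⟧ c d)) ⟩
      (⟦ a ⟧ - ⟦ b ⟧) + (C - D)    ∎
    regroup : ∀ C D A B X Y → ((C * X + A * Y) + C * Y) - ((D * X + B * Y) + D * Y) ≡
                              (C - D) * X + ((A - B) + (C - D)) * Y
    regroup = solve-∀
    factor : ∀ C D E X Y → (C - D) * X + (E * (C - D)) * Y ≡ (C - D) * (X + E * Y)
    factor = solve-∀

  form-collision : ∀ η a b c d → η *F (c -F d) ≡ (a -F b) +F (c -F d) → c ≢ d →
                   ∀ s s' → form a b c d s ≡ form a b c d s' → line η s ≡ line η s'
  form-collision η a b c d slope c≢d (x , y) (x' , y') e =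
    [ (λ c≡d → contradiction c≡d c≢d) , id ]′ (no-zero-divisors (begin
      (⟦ c ⟧ - ⟦ d ⟧) * (⟦ line η (x , y) ⟧ - ⟦ line η (x' , y') ⟧)
        ≡⟨ distribute (⟦ c ⟧ - ⟦ d ⟧) ⟦ line η (x , y) ⟧ ⟦ line η (x' , y') ⟧ ⟩
      (⟦ c ⟧ - ⟦ d ⟧) * ⟦ line η (x , y) ⟧ - (⟦ c ⟧ - ⟦ d ⟧) * ⟦ line η (x' , y') ⟧
        ≈⟨ -‿≋ (form-dilates-line η a b c d slope x y) (form-dilates-line η a b c d slope x' y') ⟨
      ⟦ form a b c d (x , y) ⟧ - ⟦ form a b c d (x' , y') ⟧
        ≡⟨ cong (λ t → ⟦ form a b c d (x , y) ⟧ - t) (cong ⟦_⟧ e) ⟨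
      ⟦ form a b c d (x , y) ⟧ - ⟦ form a b c d (x , y) ⟧
        ≡⟨ ℤ.+-inverseʳ ⟦ form a b c d (x , y) ⟧ ⟩
      + 0 ∎))
    where
    open ≋-Reasoning
    distribute : ∀ K L L' → K * (L - L') ≡ K * L - K * L'
    distribute = solve-∀

module LineEnergy (n : ℕ) (prime-p : Prime (suc n)) where
  open import Data.Nat hiding (_≟_)
  open import Data.Nat.Properties hiding (_≟_)
  open import Data.Nat.Primality using (prime)
  open import Data.Nat.Tactic.RingSolver using (solve-∀)
  open import Data.Fin using (Fin; zero; suc)
  open import Data.Fin.Properties using (_≟_) renaming (suc-injective to fin-suc-injective)
  open import Data.List using (List; length; tabulate; cartesianProduct)
  open import Data.List.Properties using (length-tabulate)
  open import Data.List.Membership.Propositional using (_∈_)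
  open import Data.List.Membership.Propositional.Properties using (∈-tabulate⁻; ∈-cartesianProduct⁻)
  open import Data.List.Relation.Unary.Unique.Propositional using (Unique)
  import Data.List.Relation.Unary.Unique.Propositional.Properties as Unique
  open import Data.Product using (∃; _×_; _,_; proj₁; proj₂)
  open import Data.Sum using ([_,_]′)
  open import Function using (id)
  open import Relation.Nullary using (yes; no; ¬?; contradiction)
  open import Relation.Binary.PropositionalEquality
  open FiniteSums

  open Residues n using (p)
  open PrimeField n prime-p
  open Energy {Fin p × Fin p} {Fin p} _≟_

  nonzero : List (Fin p)
  nonzero = tabulate {n = n} suc

  nonzero≢0 : ∀ {η} → η ∈ nonzero → η ≢ zero
  nonzero≢0 η∈ η≡0 with ∈-tabulate⁻ η∈
  ... | i , refl with () ← η≡0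

  length-nonzero : length nonzero ≡ n
  length-nonzero = length-tabulate suc

  -- Two points lie on a common line of a given nonzero slope for all p - 1
  -- slopes if they coincide, for at most one slope if they differ in both
  -- coordinates, and for none otherwise.
  common-slopes : ∀ x y x' y' → ∑[ η ∈ nonzero ] 𝟙 (line η (x , y) ≟ line η (x' , y')) ≤
                  n * (𝟙 (x ≟ x') * 𝟙 (y ≟ y')) + 𝟙 (¬? (x ≟ x')) * 𝟙 (¬? (y ≟ y'))
  common-slopes x y x' y' with x ≟ x' | y ≟ y'
  ... | yes refl | yes refl = begin
    ∑[ η ∈ nonzero ] 𝟙 (line η (x , y) ≟ line η (x , y))
      ≤⟨ ∑-mono nonzero (λ {η} _ → 𝟙≤1 (line η (x , y) ≟ line η (x , y))) ⟩
    ∑[ η ∈ nonzero ] 1                                    ≡⟨ ∑-const nonzero 1 ⟩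
    length nonzero * 1                                    ≡⟨ cong (_* 1) length-nonzero ⟩
    n * 1                                                 ≤⟨ m≤m+n _ 0 ⟩
    n * 1 + 0                                             ∎
    where open ≤-Reasoning
  ... | no x≢x' | yes refl = ≤-trans (≤-reflexive (∑-vanishes nonzero _ no-slope)) z≤n
    where
    no-slope : ∀ {η} → η ∈ nonzero → 𝟙 (line η (x , y) ≟ line η (x' , y)) ≡ 0
    no-slope {η} _ = 𝟙-false (line η (x , y) ≟ line η (x' , y)) λ e →
                       x≢x' (horizontal η {x} {x'} {y} e)
  ... | yes refl | no y≢y' = ≤-trans (≤-reflexive (∑-vanishes nonzero _ no-slope)) z≤n
    where
    no-slope : ∀ {η} → η ∈ nonzero → 𝟙 (line η (x , y) ≟ line η (x , y')) ≡ 0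
    no-slope {η} η∈ = 𝟙-false (line η (x , y) ≟ line η (x , y')) λ e →
                        [ nonzero≢0 η∈ , y≢y' ]′ (vertical η {x} {y} {y'} e)
  ... | no x≢x' | no y≢y' = ≤-trans
    (count-unique≤1 nonzero (λ η → line η (x , y) ≟ line η (x' , y'))
       (Unique.tabulate⁺ fin-suc-injective)
       λ {η₁} {η₂} _ _ e₁ e₂ → [ id , (λ y≡y' → contradiction y≡y' y≢y') ]′
                                  (one-slope η₁ η₂ {x} {y} {x'} {y'} e₁ e₂))
    (m≤n+m 1 _)

  slopes-exist : 1 ≤ n
  slopes-exist = positive prime-p
    where positive : Prime (suc n) → 1 ≤ n
          positive (prime _) = ≤-pred (nonTrivial⇒n>1 (suc n))

  module _ (B : List (Fin p)) (uB : Unique B) where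

    private
      m : ℕ
      m = length B

      S : List (Fin p × Fin p)
      S = cartesianProduct B B

    row-bound : ∀ {x y} → x ∈ B → y ∈ B →
                ∑ S (λ (x' , y') → n * (𝟙 (x ≟ x') * 𝟙 (y ≟ y')) + 𝟙 (¬? (x ≟ x')) * 𝟙 (¬? (y ≟ y')))
                ≤ n + (m ∸ 1) * (m ∸ 1)
    row-bound {x} {y} x∈B y∈B = begin
      ∑ S (λ (x' , y') → n * (𝟙 (x ≟ x') * 𝟙 (y ≟ y')) + 𝟙 (¬? (x ≟ x')) * 𝟙 (¬? (y ≟ y')))
        ≡⟨ ∑-+ S _ _ ⟩
      ∑ S (λ (x' , y') → n * (𝟙 (x ≟ x') * 𝟙 (y ≟ y'))) + ∑ S (λ (x' , y') → 𝟙 (¬? (x ≟ x')) * 𝟙 (¬? (y ≟ y')))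
        ≡⟨ cong₂ _+_ (trans (∑-*ˡ S n _) (cong (n *_) (∑-product B B _ _))) (∑-product B B _ _) ⟩
      n * (∑[ x' ∈ B ] 𝟙 (x ≟ x') * ∑[ y' ∈ B ] 𝟙 (y ≟ y')) +
      ∑[ x' ∈ B ] 𝟙 (¬? (x ≟ x')) * ∑[ y' ∈ B ] 𝟙 (¬? (y ≟ y'))
        ≤⟨ +-mono-≤ (*-monoʳ-≤ n (*-mono-≤ (at-most-once x) (at-most-once y)))
                    (*-mono-≤ (count-others _≟_ B x∈B) (count-others _≟_ B y∈B)) ⟩
      n * 1 + (m ∸ 1) * (m ∸ 1)
        ≡⟨ cong (_+ (m ∸ 1) * (m ∸ 1)) (*-identityʳ n) ⟩
      n + (m ∸ 1) * (m ∸ 1) ∎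
      where
      open ≤-Reasoning
      at-most-once : ∀ z → ∑[ z' ∈ B ] 𝟙 (z ≟ z') ≤ 1
      at-most-once z = count-unique≤1 B (z ≟_) uB (λ _ _ z≡u z≡v → trans (sym z≡u) z≡v)

    total-energy : ∑[ η ∈ nonzero ] energy (line η) S ≤ (m * m) * (n + (m ∸ 1) * (m ∸ 1))
    total-energy = begin
      ∑[ η ∈ nonzero ] ∑[ s ∈ S ] ∑[ s' ∈ S ] 𝟙 (line η s ≟ line η s')
        ≡⟨ ∑-swap nonzero S _ ⟩
      ∑[ s ∈ S ] ∑[ η ∈ nonzero ] ∑[ s' ∈ S ] 𝟙 (line η s ≟ line η s')
        ≡⟨ ∑-cong S (λ {s} _ → ∑-swap nonzero S _) ⟩
      ∑[ s ∈ S ] ∑[ s' ∈ S ] ∑[ η ∈ nonzero ] 𝟙 (line η s ≟ line η s')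
        ≤⟨ ∑-mono S (λ {(x , y)} s∈S → ≤-trans (∑-mono S (λ {(x' , y')} _ → common-slopes x y x' y'))
                                                (row-bound (proj₁ (∈-cartesianProduct⁻ B B s∈S))
                                                           (proj₂ (∈-cartesianProduct⁻ B B s∈S)))) ⟩
      ∑[ s ∈ S ] (n + (m ∸ 1) * (m ∸ 1))
        ≡⟨ ∑-const S _ ⟩
      length S * (n + (m ∸ 1) * (m ∸ 1))
        ≡⟨ cong (_* (n + (m ∸ 1) * (m ∸ 1))) (length-cartesian B B) ⟩
      (m * m) * (n + (m ∸ 1) * (m ∸ 1)) ∎
      where open ≤-Reasoning

    low-energy-slope : (m ∸ 1) * (m ∸ 1) ≤ n → ∃ λ η → energy (line η) S ≤ 2 * (m * m)
    low-energy-slope small-m with below-average nonzero (λ η → energy (line η) S)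
                                    (subst (1 ≤_) (sym length-nonzero) slopes-exist)
    ... | η , _ , average = η , *-cancelˡ-≤ n {{>-nonZero slopes-exist}} (begin
      n * energy (line η) S                     ≡⟨ cong (_* energy (line η) S) length-nonzero ⟨
      length nonzero * energy (line η) S        ≤⟨ average ⟩
      ∑[ η ∈ nonzero ] energy (line η) S        ≤⟨ total-energy ⟩
      (m * m) * (n + (m ∸ 1) * (m ∸ 1))         ≤⟨ *-monoʳ-≤ (m * m) (+-monoʳ-≤ n small-m) ⟩
      (m * m) * (n + n)                         ≡⟨ rearrange n (m * m) ⟩
      n * (2 * (m * m))                         ∎)
      where
      open ≤-Reasoning
      rearrange : ∀ n k → k * (n + n) ≡ n * (2 * k)
      rearrange = solve-∀

module SquareRoot where
  open import Data.Nat as ℕ using (ℕ; zero; suc; _≤_; _⊓_; _∸_; z≤n; _*_)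
  import Data.Nat.Properties as ℕ
  open import Data.Product using (∃; _×_; _,_)
  open import Relation.Nullary using (yes; no)

  -- For every a there is m ≤ a with (m - 1)² ≤ n and min(a², n + 1) ≤ m²;
  -- for a = |A| and p = n + 1 this is the size of B ⊆ A used below.
  square-root-choice : ∀ n a → ∃ λ m → m ≤ a × (m ∸ 1) * (m ∸ 1) ≤ n × (a * a) ⊓ suc n ≤ m * m
  square-root-choice n zero    = 0 , z≤n , z≤n , z≤n
  square-root-choice n (suc a) with a * a ℕ.≤? n
  ... | yes a²≤n = suc a , ℕ.≤-refl , a²≤n , ℕ.m⊓n≤m _ _
  ... | no  a²≰n with square-root-choice n a
  ...   | m , m≤a , small-m , large-m = m , ℕ.m≤n⇒m≤1+n m≤a , small-m , (begin
    (suc a * suc a) ⊓ suc n  ≤⟨ ℕ.m⊓n≤n _ _ ⟩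
    suc n                    ≡⟨ ℕ.m≥n⇒m⊓n≡n (ℕ.≰⇒> a²≰n) ⟨
    (a * a) ⊓ suc n          ≤⟨ large-m ⟩
    m * m                    ∎)
    where open ℕ.≤-Reasoning

module SumProductBound (n : ℕ) (prime-p : Prime (suc n)) (A : Subset (suc n)) .(nz : NonZero (suc n)) where
  open import Defs
  open import Data.Nat as ℕ using (ℕ; zero; suc; _≤_; _⊓_; _∸_; z≤n; _+_; _*_)
  import Data.Nat.Properties as ℕ
  open import Data.Fin using (Fin; zero)
  open import Data.Fin.Properties using (_≟_; any?)
  open import Data.Fin.Subset using (∣_∣) renaming (_∈_ to _∈ₛ_)
  open import Data.Fin.Subset.Properties using (_∈?_)
  open import Data.List using (List; []; _∷_; length; take; cartesianProduct)
  open import Data.List.Properties using (length-take)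
  open import Data.List.Membership.Propositional using (_∈_)
  open import Data.List.Membership.Propositional.Properties using (∈-cartesianProduct⁻)
  open import Data.List.Relation.Unary.Any using (here; there)
  open import Data.List.Relation.Unary.All using ([]; _∷_)
  open import Data.List.Relation.Unary.AllPairs using ([]; _∷_)
  open import Data.List.Relation.Unary.Unique.Propositional using (Unique)
  import Data.List.Relation.Unary.Unique.Propositional.Properties as Unique
  open import Data.List.Relation.Binary.Sublist.Propositional as Sublist using (⊆-refl)
  open import Data.List.Relation.Binary.Sublist.Heterogeneous.Properties using (take-Sublist)
  open import Data.Product using (∃; _×_; _,_; proj₁; proj₂)
  open import Relation.Nullary using (Dec; yes; no; ¬_; ¬?; contradiction)
  open import Relation.Nullary.Decidable using (_×-dec_)
  open import Relation.Binary.PropositionalEquality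
  open FiniteSums
  open SubsetLists
  open SquareRoot

  open Residues n
  open Forms (suc n) using (form)
  open PrimeField n prime-p
  open LineEnergy n prime-p
  open Energy {Fin p × Fin p} {Fin p} _≟_

  -- The difference set T = 3A² - 3A², kept opaque: the argument only uses
  -- that T contains the values of the forms g (form-∈T), and unfolding T
  -- would make the type checker evaluate it.
  opaque
    T : Subset p
    T = 𝔽.threeA²-threeA² (suc n) {{nz}} A

    T-definition : T ≡ 𝔽.threeA²-threeA² (suc n) {{nz}} A
    T-definition = refl

  form-∈T : ∀ {a b c d x y} → a ∈ₛ A → b ∈ₛ A → c ∈ₛ A → d ∈ₛ A → x ∈ₛ A → y ∈ₛ A →
            form a b c d (x , y) ∈ₛ T
  form-∈T {a} {b} {c} {d} {x} {y} a∈A b∈A c∈A d∈A x∈A y∈A =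
    subst (form a b c d (x , y) ∈ₛ_) (sym T-definition)
          (Forms.form-∈ (suc n) {{nz}} a∈A b∈A c∈A d∈A x∈A y∈A)

  Solvable : (Fin p → Fin p → Fin p → Fin p → Fin p) → Fin p → Set
  Solvable rhs η = ∃ λ a → ∃ λ b → ∃ λ c → ∃ λ d →
    a ∈ₛ A × b ∈ₛ A × c ∈ₛ A × d ∈ₛ A × c ≢ d × η *F (c -F d) ≡ rhs a b c d

  solvable? : ∀ rhs η → Dec (Solvable rhs η)
  solvable? rhs η = any? λ a → any? λ b → any? λ c → any? λ d →
    (a ∈? A) ×-dec (b ∈? A) ×-dec (c ∈? A) ×-dec (d ∈? A) ×-dec ¬? (c ≟ d) ×-dec
    (η *F (c -F d) ≟ rhs a b c d)

  Quotient : Fin p → Set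
  Quotient = Solvable (λ a b _ _ → a -F b)

  Quotient+1 : Fin p → Set
  Quotient+1 = Solvable (λ a b c d → (a -F b) +F (c -F d))

  quotient? : ∀ η → Dec (Quotient η)
  quotient? = solvable? (λ a b _ _ → a -F b)

  quotient+1? : ∀ η → Dec (Quotient+1 η)
  quotient+1? = solvable? (λ a b c d → (a -F b) +F (c -F d))

  zero∈Q : ∀ {c d} → c ∈ₛ A → d ∈ₛ A → c ≢ d → Quotient zero
  zero∈Q {c} {d} c∈A d∈A c≢d = c , c , c , d , c∈A , c∈A , c∈A , d∈A , c≢d , sym (self-difference c)

  Q+1 : ∀ η → Quotient η → Quotient+1 (η +F one)
  Q+1 η (a , b , c , d , a∈A , b∈A , c∈A , d∈A , c≢d , ratio) =
    a , b , c , d , a∈A , b∈A , c∈A , d∈A , c≢d , successor-multiple η (c -F d) (a -F b) ratio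

  -- If Q + 1 ⊆ Q, then Q = 𝔽_p, since 0 ∈ Q and 𝔽_p is generated by 1;
  -- hence Q + 1 = 𝔽_p as well.
  closed⇒Q+1-everything : Quotient zero → (∀ η → Quotient+1 η → Quotient η) → ∀ η → Quotient+1 η
  closed⇒Q+1-everything 0∈Q closed η =
    subst Quotient+1 (minus-plus η one) (Q+1 (η -F one) (Q-everything (η -F one)))
    where
    Q-everything : ∀ η → Quotient η
    Q-everything = additive-induction Quotient 0∈Q (λ η η∈Q → closed (η +F one) (Q+1 η η∈Q))

  -- Outside Q, the line map f_η is injective on A × A: two distinct points
  -- on a line of slope η exhibit η as a ratio of differences.
  injective-outside-Q : ∀ η → ¬ Quotient η → ∀ {x y x' y'} → x ∈ₛ A → y ∈ₛ A → x' ∈ₛ A → y' ∈ₛ A →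
                        line η (x , y) ≡ line η (x' , y') → (x , y) ≡ (x' , y')
  injective-outside-Q η η∉Q {x} {y} {x'} {y'} x∈A y∈A x'∈A y'∈A e with y ≟ y'
  ... | yes refl = cong (_, y) (horizontal η {x} {x'} {y} e)
  ... | no y≢y'  = contradiction (x , x' , y' , y , x∈A , x'∈A , y'∈A , y∈A , (λ y'≡y → y≢y' (sym y'≡y)) ,
                                  collision-ratio η {x} {y} {x'} {y'} e)
                                 η∉Q

  module _ (B : List (Fin p)) (uB : Unique B) (B⊆A : ∀ {x} → x ∈ B → x ∈ₛ A) where

    private
      m : ℕ
      m = length B

      S : List (Fin p × Fin p)
      S = cartesianProduct B B

      S⊆A×A : ∀ {x y} → (x , y) ∈ S → x ∈ₛ A × y ∈ₛ A
      S⊆A×A s∈S with ∈-cartesianProduct⁻ B B s∈S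
      ... | x∈B , y∈B = B⊆A x∈B , B⊆A y∈B

    large-difference-set : ∀ η → Quotient+1 η → energy (line η) S ≤ 2 * (m * m) → m * m ≤ 2 * ∣ T ∣
    large-difference-set η (a , b , c , d , a∈A , b∈A , c∈A , d∈A , c≢d , slope) low-energy =
      let (U , uU , U⊆g[S] , bound) = image-bound (form a b c d) S
          U⊆T : ∀ {u} → u ∈ U → u ∈ₛ T
          U⊆T u∈U = let ((x , y) , s∈S , gs≡u) = U⊆g[S] u∈U
                        (x∈A , y∈A) = S⊆A×A s∈S
                    in subst (_∈ₛ T) gs≡u (form-∈T a∈A b∈A c∈A d∈A x∈A y∈A)
      in ℕ.+-cancelʳ-≤ (2 * (m * m)) (m * m) (2 * ∣ T ∣) (begin
        m * m + 2 * (m * m)                    ≡⟨⟩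
        3 * (m * m)                            ≡⟨ cong (3 *_) (length-cartesian B B) ⟨
        3 * length S                           ≤⟨ bound ⟩
        2 * length U + energy (form a b c d) S
          ≤⟨ ℕ.+-mono-≤ (ℕ.*-monoʳ-≤ 2 (length≤∣∣ U T uU U⊆T))
                        (ℕ.≤-trans (energy-mono (form a b c d) (line η) S (form-collision η a b c d slope c≢d))
                                   low-energy) ⟩
        2 * ∣ T ∣ + 2 * (m * m)                ∎)
      where open ℕ.≤-Reasoning

    -- Either some η ∈ (Q + 1) \ Q makes f_η injective on B × B, or Q + 1 ⊆ Q,
    -- so that Q + 1 = 𝔽_p and averaging over the slopes supplies η.
    good-slope : ∀ {c d} → c ∈ₛ A → d ∈ₛ A → c ≢ d → (m ∸ 1) * (m ∸ 1) ≤ n →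
                 ∃ λ η → Quotient+1 η × energy (line η) S ≤ 2 * (m * m)
    good-slope c∈A d∈A c≢d small-m with any? (λ η → quotient+1? η ×-dec ¬? (quotient? η))
    ... | yes (η , η∈Q+1 , η∉Q) = η , η∈Q+1 , (begin
      energy (line η) S  ≤⟨ energy-injective (line η) S (Unique.cartesianProduct⁺ uB uB) injective ⟩
      length S           ≡⟨ length-cartesian B B ⟩
      m * m              ≤⟨ ℕ.m≤m+n (m * m) _ ⟩
      2 * (m * m)        ∎)
      where
      open ℕ.≤-Reasoning
      injective : ∀ {s s'} → s ∈ S → s' ∈ S → line η s ≡ line η s' → s ≡ s'
      injective s∈S s'∈S = injective-outside-Q η η∉Q (proj₁ (S⊆A×A s∈S)) (proj₂ (S⊆A×A s∈S))
                                                     (proj₁ (S⊆A×A s'∈S)) (proj₂ (S⊆A×A s'∈S))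
    ... | no none with low-energy-slope B uB small-m
    ...   | η , low-energy = η , closed⇒Q+1-everything (zero∈Q c∈A d∈A c≢d) Q+1⊆Q η , low-energy
      where
      Q+1⊆Q : ∀ η → Quotient+1 η → Quotient η
      Q+1⊆Q η η∈Q+1 with quotient? η
      ... | yes η∈Q = η∈Q
      ... | no  η∉Q = contradiction (η , η∈Q+1 , η∉Q) none

  square-bound : (B : List (Fin p)) → Unique B → (∀ {x} → x ∈ B → x ∈ₛ A) →
                 (length B ∸ 1) * (length B ∸ 1) ≤ n → length B * length B ≤ 2 * ∣ T ∣
  square-bound []       _  _   _ = z≤n
  square-bound (x ∷ []) _  B⊆A _ =
    ℕ.≤-trans (length≤∣∣ (g[x,x] ∷ []) T ([] ∷ []) λ { (here refl) → g[x,x]∈T }) (ℕ.m≤m+n _ _)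
    where
    g[x,x] : Fin p
    g[x,x] = form x x x x (x , x)
    g[x,x]∈T : g[x,x] ∈ₛ T
    g[x,x]∈T = let x∈A = B⊆A (here refl) in form-∈T x∈A x∈A x∈A x∈A x∈A x∈A
  square-bound B@(c ∷ d ∷ _) uB@((c≢d ∷ _) ∷ _) B⊆A small-B =
    let (η , η∈Q+1 , low-energy) =
          good-slope B uB B⊆A (B⊆A (here refl)) (B⊆A (there (here refl))) c≢d small-B
    in large-difference-set B uB B⊆A η η∈Q+1 low-energy

  difference-set-bound : (∣ A ∣ * ∣ A ∣) ⊓ suc n ≤ 2 * ∣ 𝔽.threeA²-threeA² (suc n) {{nz}} A ∣
  difference-set-bound =
    subst (λ D → (∣ A ∣ * ∣ A ∣) ⊓ suc n ≤ 2 * ∣ D ∣) {T} {𝔽.threeA²-threeA² (suc n) {{nz}} A} T-definition (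
    let (L , uL , L⊆A , length-L)       = enumerate A
        (m , m≤∣A∣ , small-m , large-m) = square-root-choice n ∣ A ∣
        B = take m L
        length-B : length B ≡ m
        length-B = trans (length-take m L) (ℕ.m≤n⇒m⊓n≡m (subst (m ≤_) (sym length-L) m≤∣A∣))
        B⊆L : ∀ {x} → x ∈ B → x ∈ L
        B⊆L = Sublist.lookup (take-Sublist m ⊆-refl)
    in begin
      (∣ A ∣ * ∣ A ∣) ⊓ suc n  ≤⟨ large-m ⟩
      m * m                    ≡⟨ cong (λ k → k * k) length-B ⟨
      length B * length B      ≤⟨ square-bound B (Unique.take⁺ m uL) (λ x∈B → L⊆A (B⊆L x∈B))
                                                 (subst (λ k → (k ∸ 1) * (k ∸ 1) ≤ n) (sym length-B) small-m) ⟩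
      2 * ∣ T ∣                ∎)
    where open ℕ.≤-Reasoning

open import Defs
open import Data.Nat using (ℕ; NonZero; _*_; _≤_; _⊓_)
open import Data.Nat.Primality using (Prime)
open import Data.Fin.Subset using (Subset; ∣_∣)

theorem3p2 : (p : ℕ) .{{_ : NonZero p}} → Prime p → (A : Subset p) →
    (∣ A ∣ * ∣ A ∣) ⊓ p ≤ 2 * ∣ 𝔽.threeA²-threeA² p A ∣
theorem3p2 zero    ()
theorem3p2 (suc n) {{nz}} prime-p A = SumProductBound.difference-set-bound n prime-p A nz
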